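{- For every graph $F$ (and all parameters $u,m,n$), $\mathcal{N}(F,G_{u,m,n})\le Z(F,G_{u,m,n})$.
   Context: The random clique graph $G_{u,m,n}$: let $C_1,\dots,C_{\binom nm}$ enumerate the $m$-subsets of $[n]$ and $B_1,\dots,B_{\binom nm}$ be i.i.d. Bernoulli with success probability $u\binom nm^{ -1}$; $G_{u,m,n}$ is the graph on $[n]$ with edge set $\bigcup_{i:B_i=1}\binom{C_i}{2}$. $\mathcal{N}(F,G)$ is the number of subgraphs of $G$ isomorphic to $F$. For a graph $\tilde F\subseteq K_n$ (on vertex set $[n]$), a family $\mathcal{C}$ of $m$-subsets of $[n]$ is an $\tilde F$-covering if $E(\tilde F)\subseteq\bigcup_{C\in\mathcal C}\binom C2$, each $C\in\mathcal C$ contains at least one edge of $\tilde F$, and $C\cap V(\tilde F)\neq C'\cap V(\tilde F)$ for all distinct $C,C'\in\mathcal C$. For a family $\mathcal C=\{C_{i_1},\dots,C_{i_s}\}$, $\mathcal B(\mathcal C)$ is the event that $B_{i_j}=1$ for all $j$. $Z(F,G_{u,m,n})$ denotes the number of pairs $(\tilde F,\mathcal C)$ such that $\tilde F\subseteq K_n$ is isomorphic to $F$, $\mathcal C$ is an $\tilde F$-covering, and $\mathcal B(\mathcal C)$ occurs. -}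

module Defs where

open import Data.Bool using (Bool; true; false; _∧_; _∨_; not; if_then_else_)
import Data.Bool as B
open import Data.Nat using (ℕ; zero; suc; _+_)
import Data.Nat as N
open import Data.Fin using (Fin)
import Data.Fin as F
open import Data.Fin.Subset using (Subset; ∣_∣; _∩_)
open import Data.Vec using (Vec; []; _∷_; lookup)
open import Data.Vec.Properties using (≡-dec)
open import Data.List using (List; map; concatMap; _++_; allFin; filterᵇ)
open import Data.Bool.ListAction using (any; all)
open import Data.Nat.ListAction using (sum)
import Data.List as L
open import Data.Product using (_×_; _,_)
open import Relation.Nullary.Decidable using (⌊_⌋)

infixr 5 _⇒ᵇ_
infix 6 _⇔ᵇ_

_⇒ᵇ_ : Bool → Bool → Bool
a ⇒ᵇ b = not a ∨ b

_⇔ᵇ_ : Bool → Bool → Bool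
a ⇔ᵇ b = ⌊ a B.≟ b ⌋

allF : (n : ℕ) → (Fin n → Bool) → Bool
allF n p = all p (allFin n)

anyF : (n : ℕ) → (Fin n → Bool) → Bool
anyF n p = any p (allFin n)

count : {A : Set} → (A → Bool) → List A → ℕ
count p xs = L.length (filterᵇ p xs)

allVecs : {A : Set} → List A → (k : ℕ) → List (Vec A k)
allVecs xs zero    = [] L.∷ L.[]
allVecs xs (suc k) = concatMap (λ x → map (x ∷_) (allVecs xs k)) xs

bools : List Bool
bools = true L.∷ false L.∷ L.[]

allSubsets : (n : ℕ) → List (Subset n)
allSubsets n = allVecs bools n

-- all sublists (order preserving) of a list; for a duplicate-free list these
-- are exactly its subfamilies, each listed once
sublists : {A : Set} → List A → List (List A)
sublists L.[]       = L.[] L.∷ L.[]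
sublists (x L.∷ xs) = map (x L.∷_) (sublists xs) ++ sublists xs

pairwiseᵇ : {A : Set} → (A → A → Bool) → List A → Bool
pairwiseᵇ p L.[]       = true
pairwiseᵇ p (x L.∷ xs) = all (p x) xs ∧ pairwiseᵇ p xs

-- An abstract simple graph F on k vertices: adjacency matrix
Adj : ℕ → Set
Adj k = Vec (Vec Bool k) k

infix 10 _⟦_,_⟧

_⟦_,_⟧ : {k : ℕ} → Adj k → Fin k → Fin k → Bool
A ⟦ a , b ⟧ = lookup (lookup A a) b

-- A subgraph of K_n: vertex set V ⊆ [n] and edge set E (as adjacency matrix)
SubK : ℕ → Set
SubK n = Subset n × Adj n

validᵇ : {n : ℕ} → SubK n → Bool
validᵇ {n} (V , E) =
  allF n (λ i → allF n (λ j →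
    not (E ⟦ i , i ⟧) ∧ (E ⟦ i , j ⟧ ⇔ᵇ E ⟦ j , i ⟧)
    ∧ (E ⟦ i , j ⟧ ⇒ᵇ (lookup V i ∧ lookup V j))))

subgraphsK : (n : ℕ) → List (SubK n)
subgraphsK n =
  filterᵇ validᵇ
    (concatMap (λ V → map (V ,_) (allVecs (allSubsets n) n)) (allSubsets n))

-- H ≅ F : there is a bijection φ : [k] → V(H) with ab ∈ E(F) ⇔ φaφb ∈ E(H)
-- (decided by searching all maps φ : Fin k → Fin n)
isoᵇ : {n k : ℕ} → Adj k → SubK n → Bool
isoᵇ {n} {k} AF (V , E) = any ok (allVecs (allFin n) k)
  where
  ok : Vec (Fin n) k → Bool
  ok φ =
    allF k (λ a → allF k (λ b →
      ⌊ lookup φ a F.≟ lookup φ b ⌋ ⇒ᵇ ⌊ a F.≟ b ⌋))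
    ∧ allF n (λ v → lookup V v ⇔ᵇ anyF k (λ a → ⌊ lookup φ a F.≟ v ⌋))
    ∧ allF k (λ a → allF k (λ b → AF ⟦ a , b ⟧ ⇔ᵇ E ⟦ lookup φ a , lookup φ b ⟧))

-- The random clique graph, for a fixed outcome of the Bernoulli variables

mSubsets : (n m : ℕ) → List (Subset n)
mSubsets n m = filterᵇ (λ C → ⌊ ∣ C ∣ N.≟ m ⌋) (allSubsets n)

-- An outcome of (B_i)_i is a map  Bsel : Subset n → Bool  (only its values on
-- m-subsets matter).  Adjacency of G_{u,m,n} for this outcome:
adjG : {n : ℕ} → (m : ℕ) → (Subset n → Bool) → Fin n → Fin n → Bool
adjG {n} m Bsel i j =
  not ⌊ i F.≟ j ⌋ ∧ any (λ C → Bsel C ∧ lookup C i ∧ lookup C j) (mSubsets n m)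

subgraphOfGᵇ : {n : ℕ} → (m : ℕ) → (Subset n → Bool) → SubK n → Bool
subgraphOfGᵇ {n} m Bsel (V , E) =
  allF n (λ i → allF n (λ j → E ⟦ i , j ⟧ ⇒ᵇ adjG m Bsel i j))

𝒩 : (n m : ℕ) → (Subset n → Bool) → {k : ℕ} → Adj k → ℕ
𝒩 n m Bsel AF =
  count (λ H → subgraphOfGᵇ m Bsel H ∧ isoᵇ AF H) (subgraphsK n)

coveringᵇ : {n : ℕ} → SubK n → List (Subset n) → Bool
coveringᵇ {n} (V , E) 𝒞 =
  allF n (λ i → allF n (λ j →
    E ⟦ i , j ⟧ ⇒ᵇ any (λ C → lookup C i ∧ lookup C j) 𝒞))
  ∧ all (λ C → anyF n (λ i → anyF n (λ j →
      E ⟦ i , j ⟧ ∧ lookup C i ∧ lookup C j))) 𝒞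
  ∧ pairwiseᵇ (λ C C' → not ⌊ ≡-dec B._≟_ (C ∩ V) (C' ∩ V) ⌋) 𝒞

eventᵇ : {n : ℕ} → (Subset n → Bool) → List (Subset n) → Bool
eventᵇ Bsel 𝒞 = all Bsel 𝒞

Z : (n m : ℕ) → (Subset n → Bool) → {k : ℕ} → Adj k → ℕ
Z n m Bsel AF =
  sum (map (λ H → if isoᵇ AF H
                  then count (λ 𝒞 → coveringᵇ H 𝒞 ∧ eventᵇ Bsel 𝒞)
                             (sublists (mSubsets n m))
                  else 0)
           (subgraphsK n))

{-# OPTIONS --safe #-}
-- It suffices to give, for every subgraph H of G, one H-covering whose event occurs.
-- Take the selected m-sets containing an edge of H and keep one of them per trace C ∩ V(H).
-- Every edge of H lies in some selected m-set C, and the representative C' of its trace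
-- still contains both endpoints, because they lie in V(H).
module Submission where

open import Defs
open import Data.Bool using (Bool; false; T; _∧_; if_then_else_)
import Data.Bool as B
open import Data.Bool.ListAction using (any)
open import Data.Bool.Properties using (T-∧)
open import Data.Nat using (ℕ; _≤_; z≤n)
open import Data.Nat.ListAction using (sum)
open import Data.Nat.Properties using (+-mono-≤; m≤n+m; ≤-trans)
open import Data.Fin using (Fin)
open import Data.Fin.Subset using (Subset; _∩_)
open import Data.Vec using (lookup)
open import Data.Vec.Properties using (≡-dec; lookup-zipWith)
open import Data.List using (List; []; _∷_; map; filterᵇ; deduplicate; allFin; concatMap)
open import Data.List.Membership.Propositional using (_∈_; find; lose)
open import Data.List.Membership.Propositional.Properties
  using (∈-allFin; ∈-filter⁺; ∈-filter⁻; ∈-length; ∈-++⁺ˡ; ∈-++⁺ʳ; ∈-map⁺)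
open import Data.List.Relation.Unary.All as All using (All)
open import Data.List.Relation.Unary.All.Properties using (all⁺; all⁻; all-filter)
import Data.List.Relation.Unary.All.Properties as All
open import Data.List.Relation.Unary.AllPairs as AllPairs using (AllPairs)
open import Data.List.Relation.Unary.Any using (here; there)
open import Data.List.Relation.Unary.Any.Properties using (any⁺; any⁻)
import Data.List.Relation.Unary.Any.Properties as Any
open import Data.List.Relation.Unary.Unique.DecSetoid.Properties using (deduplicate-!)
open import Data.List.Relation.Binary.Sublist.Propositional using (_⊆_; []; _∷_; _∷ʳ_; ⊆-trans)
open import Data.List.Relation.Binary.Sublist.Propositional.Properties using (filter-⊆)
open import Data.Product using (∃; _×_; _,_; proj₁; proj₂)
open import Function using (_∘_; Equivalence)
open import Relation.Binary using (DecSetoid; Decidable)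
import Relation.Binary.Construct.On as On
open import Relation.Binary.PropositionalEquality
  using (_≡_; refl; sym; trans; cong; subst; module ≡-Reasoning)
open import Relation.Binary.PropositionalEquality.Properties using (decSetoid)
open import Relation.Nullary using (¬?)
open import Relation.Nullary.Decidable using (⌊_⌋; fromWitnessFalse)

open Equivalence using (to; from)
open ≡-Reasoning

⇒ᵇ-intro : ∀ {a b} → (T a → T b) → T (a ⇒ᵇ b)
⇒ᵇ-intro {B.false} _ = _
⇒ᵇ-intro {B.true}  f = f _

⇒ᵇ-elim : ∀ {a b} → T (a ⇒ᵇ b) → T a → T b
⇒ᵇ-elim {B.true} ab _ = ab

if-T : ∀ {A : Set} {b} {x y : A} → T b → (if b then x else y) ≡ x
if-T {b = B.true} _ = refl

allF⁻ : ∀ {n} (p : Fin n → Bool) → T (allF n p) → ∀ i → T (p i)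
allF⁻ p h i = All.lookup (all⁺ p _ h) (∈-allFin i)

allF⁺ : ∀ {n} (p : Fin n → Bool) → (∀ i → T (p i)) → T (allF n p)
allF⁺ {n} p h = all⁻ p {allFin n} (All.tabulate (λ {i} _ → h i))

anyF⁺ : ∀ {n} (p : Fin n → Bool) i → T (p i) → T (anyF n p)
anyF⁺ p i h = any⁺ p (lose (∈-allFin i) h)

pairwiseᵇ⁺ : ∀ {A : Set} (r : A → A → Bool) {xs} →
             AllPairs (λ x y → T (r x y)) xs → T (pairwiseᵇ r xs)
pairwiseᵇ⁺ r AllPairs.[] = _
pairwiseᵇ⁺ r (h AllPairs.∷ hs) = from T-∧ (all⁻ (r _) h , pairwiseᵇ⁺ r hs)

⊆⇒∈-sublists : ∀ {A : Set} {xs ys : List A} → xs ⊆ ys → xs ∈ sublists ys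
⊆⇒∈-sublists []              = here refl
⊆⇒∈-sublists (y ∷ʳ xs⊆ys)    = ∈-++⁺ʳ _ (⊆⇒∈-sublists xs⊆ys)
⊆⇒∈-sublists (refl ∷ xs⊆ys)  = ∈-++⁺ˡ (∈-map⁺ (_ ∷_) (⊆⇒∈-sublists xs⊆ys))

deduplicate-⊆ : ∀ {A : Set} {R : A → A → Set} (R? : Decidable R) xs → deduplicate R? xs ⊆ xs
deduplicate-⊆ R? []       = []
deduplicate-⊆ R? (x ∷ xs) =
  refl ∷ ⊆-trans (filter-⊆ (¬? ∘ R? x) (deduplicate R? xs)) (deduplicate-⊆ R? xs)

1≤count : ∀ {A : Set} (p : A → Bool) {xs x} → x ∈ xs → T (p x) → 1 ≤ count p xs
1≤count p x∈xs px = ∈-length (∈-filter⁺ (B.T? ∘ p) x∈xs px)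

count≤sum : ∀ {A : Set} (p : A → Bool) (f : A → ℕ) xs →
            (∀ {x} → x ∈ xs → T (p x) → 1 ≤ f x) → count p xs ≤ sum (map f xs)
count≤sum p f []       h = z≤n
count≤sum p f (x ∷ xs) h with p x in px
... | B.true  = +-mono-≤ (h (here refl) (subst T (sym px) _)) (count≤sum p f xs (h ∘ there))
... | B.false = ≤-trans (count≤sum p f xs (h ∘ there)) (m≤n+m _ (f x))

module CanonicalCovering {n : ℕ} (m : ℕ) (Bsel : Subset n → Bool) (V : Subset n) (E : Adj n) where

  containsEdge : Subset n → Bool
  containsEdge C = anyF n (λ i → anyF n (λ j → E ⟦ i , j ⟧ ∧ lookup C i ∧ lookup C j))

  selectedWithEdge : Subset n → Bool
  selectedWithEdge C = Bsel C ∧ containsEdge C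

  traceSetoid : DecSetoid _ _
  traceSetoid = On.decSetoid (decSetoid (≡-dec B._≟_)) (_∩ V)

  open DecSetoid traceSetoid using () renaming (_≟_ to _≟-trace_)

  selected : List (Subset n)
  selected = filterᵇ selectedWithEdge (mSubsets n m)

  covering : List (Subset n)
  covering = deduplicate _≟-trace_ selected

  covering∈sublists : covering ∈ sublists (mSubsets n m)
  covering∈sublists = ⊆⇒∈-sublists
    (⊆-trans (deduplicate-⊆ _≟-trace_ selected) (filter-⊆ (B.T? ∘ selectedWithEdge) (mSubsets n m)))

  covering-selectedWithEdge : All (T ∘ selectedWithEdge) covering
  covering-selectedWithEdge =
    All.deduplicate⁺ _≟-trace_ {xs = selected} (all-filter (B.T? ∘ selectedWithEdge) (mSubsets n m))

  covering-distinctTraces : T (pairwiseᵇ (λ C C' → B.not ⌊ ≡-dec B._≟_ (C ∩ V) (C' ∩ V) ⌋) covering)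
  covering-distinctTraces =
    pairwiseᵇ⁺ _ (AllPairs.map fromWitnessFalse (deduplicate-! traceSetoid selected))

  covering-represents : ∀ {C} → C ∈ mSubsets n m → T (selectedWithEdge C) →
                        ∃ λ C' → C' ∈ covering × C ∩ V ≡ C' ∩ V
  covering-represents C∈ sel =
    find (Any.deduplicate⁺ _≟-trace_ {xs = selected} (λ r p → trans p (sym r))
           (lose (∈-filter⁺ (B.T? ∘ selectedWithEdge) C∈ sel) refl))

  sameTrace⇒∈ : ∀ {C C'} → C ∩ V ≡ C' ∩ V →
                ∀ {i} → T (lookup C i) → T (lookup V i) → T (lookup C' i)
  sameTrace⇒∈ {C} {C'} eq {i} i∈C i∈V =
    proj₁ (to T-∧ (subst T traces (from T-∧ (i∈C , i∈V))))
    where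
    traces : lookup C i ∧ lookup V i ≡ lookup C' i ∧ lookup V i
    traces = begin
      lookup C i ∧ lookup V i   ≡⟨ lookup-zipWith _∧_ i C V ⟨
      lookup (C ∩ V) i          ≡⟨ cong (λ S → lookup S i) eq ⟩
      lookup (C' ∩ V) i         ≡⟨ lookup-zipWith _∧_ i C' V ⟩
      lookup C' i ∧ lookup V i  ∎

  edge⇒endpoints∈V : T (validᵇ (V , E)) →
                     ∀ i j → T (E ⟦ i , j ⟧) → T (lookup V i) × T (lookup V j)
  edge⇒endpoints∈V valid i j ij∈E = to T-∧ (⇒ᵇ-elim endpoints∈V ij∈E)
    where
    validAt : T (B.not (E ⟦ i , i ⟧) ∧ (E ⟦ i , j ⟧ ⇔ᵇ E ⟦ j , i ⟧)
                 ∧ (E ⟦ i , j ⟧ ⇒ᵇ (lookup V i ∧ lookup V j)))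
    validAt = allF⁻ _ (allF⁻ _ valid i) j
    endpoints∈V : T (E ⟦ i , j ⟧ ⇒ᵇ (lookup V i ∧ lookup V j))
    endpoints∈V = proj₂ (to (T-∧ {E ⟦ i , j ⟧ ⇔ᵇ E ⟦ j , i ⟧})
                            (proj₂ (to (T-∧ {B.not (E ⟦ i , i ⟧)}) validAt)))

  edgeOfG⇒selectedClique : ∀ {i j} → T (adjG m Bsel i j) →
                           ∃ λ C → C ∈ mSubsets n m × T (Bsel C) × T (lookup C i) × T (lookup C j)
  edgeOfG⇒selectedClique ij∈G with C , C∈ , sel ← find (any⁻ _ _ (proj₂ (to T-∧ ij∈G))) =
    let C-sel , ij∈C = to T-∧ sel in C , C∈ , C-sel , to T-∧ ij∈C

  selectedWithEdge⁺ : ∀ {C i j} → T (Bsel C) → T (E ⟦ i , j ⟧) → T (lookup C i) → T (lookup C j) →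
                      T (selectedWithEdge C)
  selectedWithEdge⁺ {i = i} {j} C-sel ij∈E i∈C j∈C =
    from T-∧ (C-sel , anyF⁺ _ i (anyF⁺ _ j (from T-∧ (ij∈E , from T-∧ (i∈C , j∈C)))))

  covering-coversEdges : T (validᵇ (V , E)) → T (subgraphOfGᵇ m Bsel (V , E)) →
                         ∀ i j → T (E ⟦ i , j ⟧) → T (any (λ C → lookup C i ∧ lookup C j) covering)
  covering-coversEdges valid H⊆G i j ij∈E
    with C , C∈ , C-sel , i∈C , j∈C
           ← edgeOfG⇒selectedClique (⇒ᵇ-elim (allF⁻ _ (allF⁻ _ H⊆G i) j) ij∈E)
    with C' , C'∈ , sameTrace ← covering-represents C∈ (selectedWithEdge⁺ C-sel ij∈E i∈C j∈C)
    = let i∈V , j∈V = edge⇒endpoints∈V valid i j ij∈E in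
      any⁺ _ (lose C'∈ (from T-∧ ( sameTrace⇒∈ sameTrace i∈C i∈V
                                 , sameTrace⇒∈ sameTrace j∈C j∈V)))

  covering-isCovering : T (validᵇ (V , E)) → T (subgraphOfGᵇ m Bsel (V , E)) →
                        T (coveringᵇ (V , E) covering)
  covering-isCovering valid H⊆G = from T-∧
    ( allF⁺ _ (λ i → allF⁺ _ (λ j → ⇒ᵇ-intro (covering-coversEdges valid H⊆G i j)))
    , from T-∧ ( all⁻ containsEdge (All.map (proj₂ ∘ to T-∧) covering-selectedWithEdge)
               , covering-distinctTraces ))

  covering-event : T (eventᵇ Bsel covering)
  covering-event = all⁻ Bsel (All.map (proj₁ ∘ to T-∧) covering-selectedWithEdge)

∈-subgraphsK⇒valid : ∀ {n} {H : SubK n} → H ∈ subgraphsK n → T (validᵇ H)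
∈-subgraphsK⇒valid {n} H∈ = proj₂ (∈-filter⁻ (B.T? ∘ validᵇ) {xs = candidates} H∈)
  where
  candidates : List (SubK n)
  candidates = concatMap (λ V → map (V ,_) (allVecs (allSubsets n) n)) (allSubsets n)

occurringCoverings : (n m : ℕ) → (Subset n → Bool) → SubK n → ℕ
occurringCoverings n m Bsel H = count (λ 𝒞 → coveringᵇ H 𝒞 ∧ eventᵇ Bsel 𝒞) (sublists (mSubsets n m))

subgraphOfG⇒1≤occurringCoverings : ∀ {n} m (Bsel : Subset n → Bool) {H : SubK n} →
                                   T (validᵇ H) → T (subgraphOfGᵇ m Bsel H) →
                                   1 ≤ occurringCoverings n m Bsel H
subgraphOfG⇒1≤occurringCoverings m Bsel {V , E} valid H⊆G =
  1≤count _ covering∈sublists (from T-∧ (covering-isCovering valid H⊆G , covering-event))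
  where open CanonicalCovering m Bsel V E

lemma3p3 : (n m : ℕ) (Bsel : Subset n → Bool) (k : ℕ) (AF : Adj k)
           → (∀ a b → AF ⟦ a , b ⟧ ≡ AF ⟦ b , a ⟧)
           → (∀ a → AF ⟦ a , a ⟧ ≡ false)
           → 𝒩 n m Bsel AF ≤ Z n m Bsel AF
lemma3p3 n m Bsel k AF _ _ = count≤sum _ _ (subgraphsK n) coveringExists
  where
  coveringExists : ∀ {H} → H ∈ subgraphsK n → T (subgraphOfGᵇ m Bsel H ∧ isoᵇ AF H) →
                   1 ≤ (if isoᵇ AF H then occurringCoverings n m Bsel H else 0)
  coveringExists {H} H∈ H⊆G∧H≅F =
    let H⊆G , H≅F = to (T-∧ {subgraphOfGᵇ m Bsel H}) H⊆G∧H≅F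
    in subst (1 ≤_) (sym (if-T H≅F))
             (subgraphOfG⇒1≤occurringCoverings m Bsel {H} (∈-subgraphsK⇒valid H∈) H⊆G)
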